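{- Let $X,Y,Z$ be topological spaces and suppose $f:X\to Y$ is a continuous bijection. If $Y\times Z$ has the UU property, then $X\times Z$ has the UU property.
   Context: For topological spaces $X$ and $Y$, $X\times Y$ is said to have the UU (uniquely universal) property if there exists an open set $U\subseteq X\times Y$ such that for every open set $W\subseteq Y$ there is a unique $x\in X$ with $U_x=W$, where $U_x=\{y\in Y: (x,y)\in U\}$. -}

module Defs where

open import Data.Empty using (⊥)
open import Data.Unit using (⊤)
open import Data.Product using (Σ; _×_; _,_; proj₁; proj₂)
open import Relation.Binary.PropositionalEquality using (_≡_)
open import Function.Bundles using (_⇔_)

Subset : Set → Set₁
Subset A = A → Set

_≐_ : {A : Set} → Subset A → Subset A → Set
P ≐ Q = ∀ a → P a ⇔ Q a

record Topology : Set₁ where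
  field
    Carrier   : Set
    IsOpen    : Subset Carrier → Set
    open-ext  : ∀ {P Q} → P ≐ Q → IsOpen P → IsOpen Q
    open-∅    : IsOpen (λ _ → ⊥)
    open-full : IsOpen (λ _ → ⊤)
    open-∩    : ∀ {P Q} → IsOpen P → IsOpen Q → IsOpen (λ a → P a × Q a)
    open-⋃    : (I : Set) (F : I → Subset Carrier) →
                (∀ i → IsOpen (F i)) → IsOpen (λ a → Σ I (λ i → F i a))
open Topology public

Continuous : (X Y : Topology) → (Carrier X → Carrier Y) → Set₁
Continuous X Y f = ∀ (W : Subset (Carrier Y)) → IsOpen Y W → IsOpen X (λ x → W (f x))

Bijective : {A B : Set} → (A → B) → Set
Bijective {A} {B} f = (∀ a a' → f a ≡ f a' → a ≡ a') × (∀ b → Σ A (λ a → f a ≡ b))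

IsOpenProd : (X Y : Topology) → Subset (Carrier X × Carrier Y) → Set₁
IsOpenProd X Y U =
  ∀ x y → U (x , y) →
    Σ (Subset (Carrier X)) λ A → Σ (Subset (Carrier Y)) λ B →
      IsOpen X A × IsOpen Y B × A x × B y ×
      (∀ x' y' → A x' → B y' → U (x' , y'))

section : {A B : Set} → Subset (A × B) → A → Subset B
section U x y = U (x , y)

-- The UU (uniquely universal) property of X × Y: there is an open U ⊆ X × Y
-- such that for every open W ⊆ Y there is a unique x ∈ X with U_x = W.
UU : (X Y : Topology) → Set₁
UU X Y =
  Σ (Subset (Carrier X × Carrier Y)) λ U →
    IsOpenProd X Y U ×
    (∀ (W : Subset (Carrier Y)) → IsOpen Y W →
       Σ (Carrier X) λ x → (section U x ≐ W) ×
         (∀ x' → section U x' ≐ W → x' ≡ x))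

module Submission where

-- Let U ⊆ Y × Z witness the UU property of Y × Z and pull it
-- back along f in the first coordinate: U' = (f × id)⁻¹ U ⊆ X × Z.
--   * U' is open in X × Z: a rectangle A × B ⊆ U around (f x , z) pulls back
--     to the rectangle f⁻¹A × B ⊆ U' around (x , z), and f⁻¹A is open by
--     continuity.  This only uses continuity of f.
--   * The sections of U' are those of U: U'_x = U_(f x), by definition.
--   * Given an open W ⊆ Z, let y be the unique point with U_y = W.
--     Surjectivity gives x with f x = y, so U'_x = W; if also U'_x' = W then
--     U_(f x') = W, hence f x' = y = f x by uniqueness, and x' = x by
--     injectivity.

open import Defs
open import Data.Product using (Σ; _×_; _,_)
open import Relation.Binary.PropositionalEquality using (_≡_; refl)

pullbackFirst : {A B C : Set} → (A → B) → Subset (B × C) → Subset (A × C)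
pullbackFirst g U (a , c) = U (g a , c)

pullbackFirst-open : (X Y Z : Topology) (g : Carrier X → Carrier Y) →
                     Continuous X Y g → (U : Subset (Carrier Y × Carrier Z)) →
                     IsOpenProd Y Z U → IsOpenProd X Z (pullbackFirst g U)
pullbackFirst-open X Y Z g g-cont U U-open x z xz∈U'
  with U-open (g x) z xz∈U'
... | A , B , A-open , B-open , gx∈A , z∈B , A×B⊆U =
  (λ x' → A (g x')) , B , g-cont A A-open , B-open , gx∈A , z∈B ,
  λ x' z' gx'∈A z'∈B → A×B⊆U (g x') z' gx'∈A z'∈B

Universal : {A B : Set} → Subset (A × B) → Subset B → Subset A
Universal U W a = section U a ≐ W

-- Since (pullbackFirst g U)_a = U_(g a) definitionally, a point b that is
-- uniquely universal for W in U yields, through any bijection g, a point g⁻¹ b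
-- that is uniquely universal for W in the pullback: existence uses
-- surjectivity, uniqueness uses injectivity.
pullbackFirst-uniquelyUniversal :
  {A B C : Set} (g : A → B) → Bijective g →
  (U : Subset (B × C)) (W : Subset C) (b : B) →
  Universal U W b → (∀ b' → Universal U W b' → b' ≡ b) →
  Σ A λ a → Universal (pullbackFirst g U) W a ×
    (∀ a' → Universal (pullbackFirst g U) W a' → a' ≡ a)
pullbackFirst-uniquelyUniversal g (g-inj , g-surj) U W b b-universal b-unique
  with g-surj b
... | a , refl = a , b-universal , a-unique
  where
  a-unique : ∀ a' → Universal (pullbackFirst g U) W a' → a' ≡ a
  a-unique a' a'-universal = g-inj a' a (b-unique (g a') a'-universal)

lemma9 : (X Y Z : Topology) (f : Carrier X → Carrier Y) →
         Continuous X Y f → Bijective f → UU Y Z → UU X Z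
lemma9 X Y Z f f-cont f-bij (U , U-open , U-universal) =
  pullbackFirst f U ,
  pullbackFirst-open X Y Z f f-cont U U-open ,
  λ W W-open →
    let (y , y-universal , y-unique) = U-universal W W-open
    in pullbackFirst-uniquelyUniversal f f-bij U W y y-universal y-unique
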